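{- For all integers $1\le\delta<\Delta$, the family $\mathcal{K}_{\delta,\Delta}$ is non-empty.
   Context: All graphs are finite and simple. For $1\le\delta<\Delta$, $\mathcal{K}_{\delta,\Delta}$ is the family of graphs with $\Delta+2$ vertices, one of which has degree $\delta$, and such that: if $\delta$ is even, the other $\Delta+1$ vertices have degree $\Delta$; if $\delta$ is odd, $\Delta$ of the other vertices have degree $\Delta$ and the last vertex has degree $\Delta-1$. -}

module Defs where

open import Data.Nat using (ℕ; suc; _∸_)
open import Data.Bool using (Bool; true; false)
open import Data.Fin using (Fin)
open import Data.Fin.Properties using ()
open import Data.Vec.Functional using (Vector)
open import Data.Vec.Functional using () renaming (foldr to vfoldr)
open import Data.Nat.Properties using ()
open import Data.Nat using (_+_)
open import Data.Product using (Σ; _×_; ∃)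
open import Relation.Binary.PropositionalEquality using (_≡_; _≢_)
open import Data.Nat using (_%_)

record Graph (n : ℕ) : Set where
  field
    adj   : Fin n → Fin n → Bool
    sym   : ∀ u v → adj u v ≡ adj v u
    irrefl : ∀ v → adj v v ≡ false
open Graph public

countTrue : ∀ {n} → (Fin n → Bool) → ℕ
countTrue {n} f = vfoldr (λ b acc → (if b then 1 else 0) + acc) 0 f
  where open import Data.Bool using (if_then_else_)

degree : ∀ {n} → Graph n → Fin n → ℕ
degree G v = countTrue (adj G v)

Even : ℕ → Set
Even d = d % 2 ≡ 0

Odd : ℕ → Set
Odd d = d % 2 ≡ 1

InK : (δ Δ : ℕ) → Graph (suc (suc Δ)) → Set
InK δ Δ G =
  Σ (Fin (suc (suc Δ))) λ v →
    degree G v ≡ δ ×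
    ( (Even δ → ∀ u → u ≢ v → degree G u ≡ Δ)
    × (Odd δ → Σ (Fin (suc (suc Δ))) λ w →
          w ≢ v × degree G w ≡ Δ ∸ 1 ×
          (∀ u → u ≢ v → u ≢ w → degree G u ≡ Δ)))

{-# OPTIONS --safe #-}
-- The complement of a matching on the first 2c of Δ + 1 vertices is Δ-regular except
-- that the 2c matched vertices lose one degree. Add a new vertex joined to the first δ
-- of them. If δ = 2c every old vertex is back to degree Δ and the new one has degree δ;
-- if δ = 2c − 1 the same holds except for vertex δ, which keeps degree Δ − 1.
module Submission where

open import Defs
open import Data.Nat using (ℕ; suc; _≤_; _<_)
open import Data.Product using (Σ)

open import Data.Bool using (Bool; true; false; not; _∧_; _∨_; if_then_else_)
open import Data.Empty using (⊥; ⊥-elim)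
open import Data.Fin using (Fin; zero; suc; toℕ; fromℕ<)
open import Data.Fin.Properties using (_≟_; toℕ-fromℕ<; toℕ-injective)
open import Data.Nat using (zero; _+_; _∸_; _<ᵇ_; s≤s; z≤n)
open import Data.Nat.Properties using (+-suc; +-comm; +-assoc; +-cancelʳ-≡; m+n∸n≡m; suc-injective; <⇒≤; m<n⇒m<1+n)
open import Data.Product using (_×_; _,_)
open import Data.Sum using (_⊎_; inj₁; inj₂)
open import Relation.Nullary using (does; yes; no)
open import Relation.Nullary.Decidable using (dec-true)
open import Relation.Binary.PropositionalEquality as ≡
  using (_≡_; _≢_; refl; cong; cong₂; trans; subst; module ≡-Reasoning)

indicator : Bool → ℕ
indicator b = if b then 1 else 0

<ᵇ-suc : ∀ {m n} → m ≢ n → (m <ᵇ suc n) ≡ (m <ᵇ n)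
<ᵇ-suc {zero}  {zero}  m≢n = ⊥-elim (m≢n refl)
<ᵇ-suc {zero}  {suc n} _   = refl
<ᵇ-suc {suc m} {zero}  _   = refl
<ᵇ-suc {suc m} {suc n} m≢n = <ᵇ-suc (λ m≡n → m≢n (cong suc m≡n))

n<ᵇn≡false : ∀ n → (n <ᵇ n) ≡ false
n<ᵇn≡false zero    = refl
n<ᵇn≡false (suc n) = n<ᵇn≡false n

n<ᵇ1+n≡true : ∀ n → (n <ᵇ suc n) ≡ true
n<ᵇ1+n≡true zero    = refl
n<ᵇ1+n≡true (suc n) = n<ᵇ1+n≡true n

even⊎odd : ∀ n → (Σ ℕ λ c → n ≡ c + c × Even n) ⊎ (Σ ℕ λ c → suc n ≡ c + c × Odd n)
even⊎odd zero          = inj₁ (0 , refl , refl)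
even⊎odd (suc zero)    = inj₂ (1 , refl , refl)
even⊎odd (suc (suc n)) with even⊎odd n
... | inj₁ (c , n≡2c , even)   = inj₁ (suc c , cong suc (trans (cong suc n≡2c) (≡.sym (+-suc c c))) , even)
... | inj₂ (c , 1+n≡2c , odd)  = inj₂ (suc c , cong suc (trans (cong suc 1+n≡2c) (≡.sym (+-suc c c))) , odd)

¬even∧odd : ∀ {n} → Even n → Odd n → ⊥
¬even∧odd even odd with () ← trans (≡.sym even) odd

countTrue-false : ∀ n → countTrue {n} (λ _ → false) ≡ 0
countTrue-false zero = refl
countTrue-false (suc n) = countTrue-false n

countTrue-+-not : ∀ {n} (f : Fin n → Bool) → countTrue f + countTrue (λ i → not (f i)) ≡ n
countTrue-+-not {zero} f = refl
countTrue-+-not {suc n} f with f zero | countTrue-+-not (λ i → f (suc i))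
... | true  | eq = cong suc eq
... | false | eq = trans (+-suc (countTrue (λ i → f (suc i))) _) (cong suc eq)

countTrue-∨ : ∀ {n} (f g : Fin n → Bool) → (∀ i → f i ∧ g i ≡ false) →
              countTrue (λ i → f i ∨ g i) ≡ countTrue f + countTrue g
countTrue-∨ {zero} f g disjoint = refl
countTrue-∨ {suc n} f g disjoint
  with f zero | g zero | disjoint zero | countTrue-∨ (λ i → f (suc i)) (λ i → g (suc i)) (λ i → disjoint (suc i))
... | true  | false | _ | eq = cong suc eq
... | false | true  | _ | eq = trans (cong suc eq) (≡.sym (+-suc (countTrue (λ i → f (suc i))) _))
... | false | false | _ | eq = eq

countTrue-≟ : ∀ {n} (u : Fin n) → countTrue (λ w → does (u ≟ w)) ≡ 1
countTrue-≟ {suc n} zero = cong suc (countTrue-false n)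
countTrue-≟ (suc u) = countTrue-≟ u

countTrue-<ᵇ : ∀ {n} k → k ≤ n → countTrue {n} (λ i → toℕ i <ᵇ k) ≡ k
countTrue-<ᵇ {n} zero z≤n = countTrue-false n
countTrue-<ᵇ (suc k) (s≤s k≤n) = cong suc (countTrue-<ᵇ k k≤n)

≟-sym : ∀ {n} (u w : Fin n) → does (u ≟ w) ≡ does (w ≟ u)
≟-sym u w with u ≟ w | w ≟ u
... | yes _   | yes _   = refl
... | no  _   | no  _   = refl
... | yes u≡w | no  w≢u = ⊥-elim (w≢u (≡.sym u≡w))
... | no  u≢w | yes w≡u = ⊥-elim (u≢w (≡.sym w≡u))

complement : ∀ {n} → Graph n → Graph n
complement H = record
  { adj    = λ u w → not (does (u ≟ w) ∨ adj H u w)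
  ; sym    = λ u w → cong₂ (λ e a → not (e ∨ a)) (≟-sym u w) (Graph.sym H u w)
  ; irrefl = λ u → cong (λ e → not (e ∨ adj H u u)) (dec-true (u ≟ u) refl)
  }

degree-complement : ∀ {n} (H : Graph n) u → suc (degree H u + degree (complement H) u) ≡ n
degree-complement {n} H u = begin
  suc (degree H u) + countTrue (λ w → not (nonNeighbour w))
    ≡⟨ cong (_+ countTrue (λ w → not (nonNeighbour w))) (≡.sym nonNeighbours) ⟩
  countTrue nonNeighbour + countTrue (λ w → not (nonNeighbour w))
    ≡⟨ countTrue-+-not nonNeighbour ⟩
  n ∎
  where
  open ≡-Reasoning
  nonNeighbour : Fin n → Bool
  nonNeighbour w = does (u ≟ w) ∨ adj H u w
  loopless : ∀ w → does (u ≟ w) ∧ adj H u w ≡ false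
  loopless w with u ≟ w
  ... | yes refl = irrefl H u
  ... | no  _    = refl
  nonNeighbours : countTrue nonNeighbour ≡ suc (degree H u)
  nonNeighbours = trans (countTrue-∨ _ _ loopless) (cong (_+ degree H u) (countTrue-≟ u))

cone : ∀ {n} → (Fin n → Bool) → Graph n → Graph (suc n)
cone {n} S H = record { adj = coneAdj ; sym = coneSym ; irrefl = coneIrrefl }
  where
  coneAdj : Fin (suc n) → Fin (suc n) → Bool
  coneAdj zero    zero    = false
  coneAdj zero    (suc w) = S w
  coneAdj (suc u) zero    = S u
  coneAdj (suc u) (suc w) = adj H u w
  coneSym : ∀ u w → coneAdj u w ≡ coneAdj w u
  coneSym zero    zero    = refl
  coneSym zero    (suc w) = refl
  coneSym (suc u) zero    = refl
  coneSym (suc u) (suc w) = Graph.sym H u w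
  coneIrrefl : ∀ u → coneAdj u u ≡ false
  coneIrrefl zero    = refl
  coneIrrefl (suc u) = irrefl H u

matched : ℕ → ℕ → ℕ → Bool
matched zero    _             _             = false
matched (suc c) 0             1             = true
matched (suc c) 1             0             = true
matched (suc c) (suc (suc a)) (suc (suc b)) = matched c a b
matched (suc c) _             _             = false

matched-sym : ∀ c a b → matched c a b ≡ matched c b a
matched-sym zero    a             b             = refl
matched-sym (suc c) 0             0             = refl
matched-sym (suc c) 0             1             = refl
matched-sym (suc c) 0             (suc (suc b)) = refl
matched-sym (suc c) 1             0             = refl
matched-sym (suc c) 1             1             = refl
matched-sym (suc c) 1             (suc (suc b)) = refl
matched-sym (suc c) (suc (suc a)) 0             = refl
matched-sym (suc c) (suc (suc a)) 1             = refl
matched-sym (suc c) (suc (suc a)) (suc (suc b)) = matched-sym c a b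

matched-irrefl : ∀ c a → matched c a a ≡ false
matched-irrefl zero    a             = refl
matched-irrefl (suc c) 0             = refl
matched-irrefl (suc c) 1             = refl
matched-irrefl (suc c) (suc (suc a)) = matched-irrefl c a

matching : ∀ {n} → ℕ → Graph n
matching c = record
  { adj    = λ u w → matched c (toℕ u) (toℕ w)
  ; sym    = λ u w → matched-sym c (toℕ u) (toℕ w)
  ; irrefl = λ u → matched-irrefl c (toℕ u)
  }

degree-matching : ∀ {n} c (u : Fin n) → c + c ≤ n → degree (matching c) u ≡ indicator (toℕ u <ᵇ c + c)
degree-matching {n} zero u _ = countTrue-false n
degree-matching (suc c) u le rewrite +-suc c c with le
... | s≤s (s≤s {n = m} le′) with u
...   | zero          = cong suc (countTrue-false m)
...   | suc zero      = cong suc (countTrue-false m)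
...   | suc (suc u′)  = degree-matching c u′ le′

K-graph : (c δ Δ : ℕ) → Graph (suc (suc Δ))
K-graph c δ Δ = cone (λ i → toℕ i <ᵇ δ) (complement (matching c))

degree-K-apex : ∀ c δ Δ → δ ≤ suc Δ → degree (K-graph c δ Δ) zero ≡ δ
degree-K-apex c δ Δ = countTrue-<ᵇ δ

degree-K-suc : ∀ c δ Δ → c + c ≤ suc Δ → (i : Fin (suc Δ)) →
               degree (K-graph c δ Δ) (suc i) + indicator (toℕ i <ᵇ c + c) ≡ indicator (toℕ i <ᵇ δ) + Δ
degree-K-suc c δ Δ le i = begin
  inApex + degree cM i + indicator (toℕ i <ᵇ c + c)
    ≡⟨ cong (inApex + degree cM i +_) (≡.sym (degree-matching c i le)) ⟩
  inApex + degree cM i + degree M i   ≡⟨ +-assoc inApex _ _ ⟩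
  inApex + (degree cM i + degree M i) ≡⟨ cong (inApex +_) (+-comm (degree cM i) (degree M i)) ⟩
  inApex + (degree M i + degree cM i) ≡⟨ cong (inApex +_) (suc-injective (degree-complement M i)) ⟩
  inApex + Δ                          ∎
  where
  open ≡-Reasoning
  inApex : ℕ
  inApex = indicator (toℕ i <ᵇ δ)
  M cM : Graph (suc Δ)
  M  = matching c
  cM = complement M

degree-K-regular : ∀ c δ Δ → c + c ≤ suc Δ → ∀ i → (toℕ i <ᵇ c + c) ≡ (toℕ i <ᵇ δ) →
                   degree (K-graph c δ Δ) (suc i) ≡ Δ
degree-K-regular c δ Δ le i same = +-cancelʳ-≡ (indicator (toℕ i <ᵇ δ)) _ _ (begin
  d + indicator (toℕ i <ᵇ δ)     ≡⟨ cong (λ b → d + indicator b) (≡.sym same) ⟩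
  d + indicator (toℕ i <ᵇ c + c) ≡⟨ degree-K-suc c δ Δ le i ⟩
  indicator (toℕ i <ᵇ δ) + Δ     ≡⟨ +-comm _ Δ ⟩
  Δ + indicator (toℕ i <ᵇ δ)     ∎)
  where
  open ≡-Reasoning
  d : ℕ
  d = degree (K-graph c δ Δ) (suc i)

degree-K-odd-exception : ∀ c δ Δ → suc δ ≡ c + c → c + c ≤ suc Δ →
                         ∀ i → toℕ i ≡ δ → degree (K-graph c δ Δ) (suc i) ≡ Δ ∸ 1
degree-K-odd-exception c δ Δ 1+δ≡2c le i refl = begin
  d         ≡⟨ ≡.sym (m+n∸n≡m d 1) ⟩
  d + 1 ∸ 1 ≡⟨ cong (_∸ 1) d+1≡Δ ⟩
  Δ ∸ 1     ∎
  where
  open ≡-Reasoning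
  d : ℕ
  d = degree (K-graph c δ Δ) (suc i)
  d+1≡Δ : d + 1 ≡ Δ
  d+1≡Δ = begin
    d + 1                          ≡⟨ cong (λ b → d + indicator b) (≡.sym (n<ᵇ1+n≡true δ)) ⟩
    d + indicator (δ <ᵇ suc δ)     ≡⟨ cong (λ k → d + indicator (δ <ᵇ k)) 1+δ≡2c ⟩
    d + indicator (δ <ᵇ c + c)     ≡⟨ degree-K-suc c δ Δ le i ⟩
    indicator (δ <ᵇ δ) + Δ         ≡⟨ cong (λ b → indicator b + Δ) (n<ᵇn≡false δ) ⟩
    Δ                              ∎

-- The construction also works for δ = 0.
proposition2p11 : (δ Δ : ℕ) → 1 ≤ δ → δ < Δ →
    Σ (Graph (suc (suc Δ))) λ G → InK δ Δ G
proposition2p11 δ Δ _ δ<Δ with even⊎odd δ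
... | inj₁ (c , δ≡2c , even) =
  K-graph c δ Δ , zero , degree-K-apex c δ Δ (<⇒≤ δ<1+Δ) , (λ _ → regular) , (λ odd → ⊥-elim (¬even∧odd {δ} even odd))
  where
  δ<1+Δ : δ < suc Δ
  δ<1+Δ = m<n⇒m<1+n δ<Δ
  regular : ∀ u → u ≢ zero → degree (K-graph c δ Δ) u ≡ Δ
  regular zero    u≢0 = ⊥-elim (u≢0 refl)
  regular (suc i) _   = degree-K-regular c δ Δ (subst (_≤ suc Δ) δ≡2c (<⇒≤ δ<1+Δ)) i
    (cong (toℕ i <ᵇ_) (≡.sym δ≡2c))
... | inj₂ (c , 1+δ≡2c , odd) =
  K-graph c δ Δ , zero , degree-K-apex c δ Δ (<⇒≤ δ<1+Δ) , (λ even → ⊥-elim (¬even∧odd {δ} even odd)) ,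
  λ _ → suc w , (λ ()) , degree-K-odd-exception c δ Δ 1+δ≡2c 2c≤1+Δ w (toℕ-fromℕ< δ<1+Δ) , regular
  where
  δ<1+Δ : δ < suc Δ
  δ<1+Δ = m<n⇒m<1+n δ<Δ
  2c≤1+Δ : c + c ≤ suc Δ
  2c≤1+Δ = subst (_≤ suc Δ) 1+δ≡2c δ<1+Δ
  w : Fin (suc Δ)
  w = fromℕ< δ<1+Δ
  regular : ∀ u → u ≢ zero → u ≢ suc w → degree (K-graph c δ Δ) u ≡ Δ
  regular zero    u≢0 _   = ⊥-elim (u≢0 refl)
  regular (suc i) _   i≢w = degree-K-regular c δ Δ 2c≤1+Δ i
    (trans (cong (toℕ i <ᵇ_) (≡.sym 1+δ≡2c)) (<ᵇ-suc i≢δ))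
    where
    i≢δ : toℕ i ≢ δ
    i≢δ i≡δ = i≢w (cong suc (toℕ-injective (trans i≡δ (≡.sym (toℕ-fromℕ< δ<1+Δ)))))
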